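{- $$\sum_{n\ge1}a_{n,3,00}x^n=\frac{x(1-3x+6x^2-5x^3+3x^4-x^5)}{(1-x)^6}.$$
   Context: For a finite integer sequence $(a_1,\dots,a_i)$, $\mathrm{asc}(a_1,\dots,a_i)=|\{j:1\le j<i,\ a_j<a_{j+1}\}|$. A $3$-ascent sequence of length $n\ge1$ is a sequence $(a_1,\dots,a_n)$ of nonnegative integers with $a_1=0$ and $a_i\le 3+\mathrm{asc}(a_1,\dots,a_{i-1})$ for all $2\le i\le n$. $a_{n,3,00}$ is the number of $3$-ascent sequences of length $n$ avoiding the pattern $00$, i.e. having all letters distinct. -}

module Defs where

open import Data.Nat using (ℕ; zero; suc; _+_; _∸_; _<ᵇ_; _≤ᵇ_; _≡ᵇ_)
open import Data.Bool using (Bool; true; false; _∧_; not; if_then_else_)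
open import Data.List using (List; []; _∷_; length; filterᵇ; map; concatMap; upTo; take; lookup; sum)
open import Data.Bool.ListAction using (any)
open import Data.Integer as ℤ using (ℤ)

asc : List ℕ → ℕ
asc [] = 0
asc (x ∷ []) = 0
asc (x ∷ y ∷ ys) = (if x <ᵇ y then 1 else 0) + asc (y ∷ ys)

-- the entry at 0-based position i (i.e. a_{i+1}); 0 if out of range (never used out of range)
at : List ℕ → ℕ → ℕ
at [] _ = 0
at (x ∷ xs) zero = x
at (x ∷ xs) (suc i) = at xs i

-- k-ascent sequence: a_1 = 0 and for 2 ≤ i ≤ n, a_i ≤ k + asc(a_1,…,a_{i-1}).
-- With 0-based index j = i-1 ∈ {1,…,n-1}: at s j ≤ k + asc (take j s).
isAscentSeq : ℕ → List ℕ → Bool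
isAscentSeq k [] = false                       -- sequences have length n ≥ 1
isAscentSeq k (a₁ ∷ rest) =
  (a₁ ≡ᵇ 0) ∧ allᵇ (map suc (upTo (length rest)))
  where
    s = a₁ ∷ rest
    allᵇ : List ℕ → Bool
    allᵇ [] = true
    allᵇ (j ∷ js) = (at s j ≤ᵇ k + asc (take j s)) ∧ allᵇ js

-- avoids the pattern 00: all letters distinct
allDistinct : List ℕ → Bool
allDistinct [] = true
allDistinct (x ∷ xs) = not (any (λ y → x ≡ᵇ y) xs) ∧ allDistinct xs

allLists : ℕ → ℕ → List (List ℕ)
allLists b zero = [] ∷ []
allLists b (suc n) = concatMap (λ x → map (x ∷_) (allLists b n)) (upTo b)

-- a_{n,3,00} for n ≥ 1.  Every 3-ascent sequence of length n has entries
-- ≤ 3 + (n-2) < n + 3, so enumerating allLists (n + 3) n is exhaustive.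
a3-00 : ℕ → ℕ
a3-00 n = length (filterᵇ (λ s → isAscentSeq 3 s ∧ allDistinct s) (allLists (n + 3) n))

FPS : Set
FPS = ℕ → ℤ

_·_ : FPS → FPS → FPS
(f · g) n = sumℤ (map (λ k → f k ℤ.* g (n ∸ k)) (upTo (suc n)))
  where
    sumℤ : List ℤ → ℤ
    sumℤ [] = ℤ.0ℤ
    sumℤ (x ∷ xs) = x ℤ.+ sumℤ xs

poly : List ℤ → FPS
poly [] _ = ℤ.0ℤ
poly (c ∷ cs) zero = c
poly (c ∷ cs) (suc n) = poly cs n

A : FPS
A zero = ℤ.0ℤ
A (suc n) = ℤ.+ (a3-00 (suc n))

-- (1 - x)^6 = 1 - 6x + 15x^2 - 20x^3 + 15x^4 - 6x^5 + x^6
denom : FPS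
denom = poly (ℤ.+ 1 ∷ ℤ.- ℤ.+ 6 ∷ ℤ.+ 15 ∷ ℤ.- ℤ.+ 20 ∷ ℤ.+ 15 ∷ ℤ.- ℤ.+ 6 ∷ ℤ.+ 1 ∷ [])

numer : FPS
numer = poly (ℤ.0ℤ ∷ ℤ.+ 1 ∷ ℤ.- ℤ.+ 3 ∷ ℤ.+ 6 ∷ ℤ.- ℤ.+ 5 ∷ ℤ.+ 3 ∷ ℤ.- ℤ.+ 1 ∷ [])

-- After a prefix with letter
-- set U, last letter ℓ and a ascents, the admissible next letters are the x ≤ k + a outside U.
-- If c letters are admissible and i of them lie below ℓ, then appending the r-th admissible
-- letter is an ascent exactly when i ≤ r, and afterwards c − 1 letters are admissible, plus
-- the fresh letter k + a + 1 after an ascent.  Hence the number of continuations depends only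
-- on (i, c), and a_{n+1,3,00} is the count for n letters from (0, 3).  The states reachable
-- from (0, 3) form a chain of six, each step staying put or moving down the chain, so
-- n ↦ a_{n+1,3,00} has vanishing sixth difference: A · (1 − x)^6 is a polynomial of
-- degree at most 6, and its coefficients are computed.

module Submission where

open import Defs
open import Data.Nat using (ℕ)
open import Relation.Binary.PropositionalEquality using (_≡_)

module Counting where

  open import Algebra.Bundles using (CommutativeMonoid)
  open import Data.Nat
  open import Data.Nat.Properties
  open import Data.Nat.ListAction using (sum)
  open import Data.Nat.ListAction.Properties using (sum-++)
  open import Data.Bool using (Bool; true; false; _∧_; _∨_; not; if_then_else_)
  open import Data.Bool.Properties using (∧-assoc; ∧-identityʳ; ∧-zeroʳ; ∨-assoc; ∨-identityʳ; ∨-zeroʳ; ∧-commutativeMonoid)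
  open import Data.Bool.ListAction using (any; all)
  open import Data.List using (List; []; _∷_; _++_; _∷ʳ_; [_]; length; map; foldr; filterᵇ; concatMap; upTo; applyUpTo; take)
  open import Data.List.Properties using (filter-++; length-++; upTo-∷ʳ; map-++; foldr-universal; foldr-map; map-upTo; applyUpTo-∷ʳ; ++-identityʳ; ∷ʳ-++)
  open import Data.List.Relation.Unary.All as All using (All; []; _∷_)
  open import Data.List.Relation.Unary.All.Properties using (++⁺)
  open import Data.Sum using (inj₁; inj₂)
  open import Function using (_∘_)
  open import Relation.Binary.Definitions using (tri<; tri≈; tri>)
  open import Relation.Binary.PropositionalEquality hiding ([_])
  open import Relation.Nullary using (contradiction)
  open import Relation.Nullary.Decidable using (yes; no; T?; dec-true; dec-false)
  open import Algebra.Properties.CommutativeSemigroup (CommutativeMonoid.commutativeSemigroup ∧-commutativeMonoid) using () renaming (interchange to ∧-interchange)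

  bit : Bool → ℕ
  bit b = if b then 1 else 0

  bit≤1 : ∀ b → bit b ≤ 1
  bit≤1 true  = ≤-refl
  bit≤1 false = z≤n

  sumBelow : ℕ → (ℕ → ℕ) → ℕ
  sumBelow zero    f = 0
  sumBelow (suc n) f = sumBelow n f + f n

  sumBelow-cong : ∀ n {f g : ℕ → ℕ} → (∀ x → x < n → f x ≡ g x) → sumBelow n f ≡ sumBelow n g
  sumBelow-cong zero    f≡g = refl
  sumBelow-cong (suc n) f≡g =
    cong₂ _+_ (sumBelow-cong n (λ x x<n → f≡g x (m<n⇒m<1+n x<n))) (f≡g n ≤-refl)

  sumBelow-only-zero : ∀ n {f : ℕ → ℕ} → (∀ x → f (suc x) ≡ 0) → sumBelow (suc n) f ≡ f 0
  sumBelow-only-zero zero    f0 = refl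
  sumBelow-only-zero (suc n) {f} f0 =
    trans (cong (sumBelow (suc n) f +_) (f0 n)) (trans (+-identityʳ _) (sumBelow-only-zero n f0))

  count : (ℕ → Bool) → ℕ → ℕ
  count p n = sumBelow n (bit ∘ p)

  count-cong : ∀ n {p q : ℕ → Bool} → (∀ x → x < n → p x ≡ q x) → count p n ≡ count q n
  count-cong n p≡q = sumBelow-cong n (λ x x<n → cong bit (p≡q x x<n))

  count-mono : ∀ p {m n} → m ≤ n → count p m ≤ count p n
  count-mono p {n = zero}  z≤n = ≤-refl
  count-mono p {n = suc n} m≤1+n with m≤n⇒m<n∨m≡n m≤1+n
  ... | inj₁ m<1+n = ≤-trans (count-mono p (≤-pred m<1+n)) (m≤m+n _ _)
  ... | inj₂ refl  = ≤-refl

  count-suc : ∀ {p} x → p x ≡ true → count p (suc x) ≡ suc (count p x)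
  count-suc {p} x px rewrite px = +-comm _ 1

  count-insert : ∀ {p q : ℕ → Bool} {z} n → z < n → p z ≡ true → q z ≡ false →
                 (∀ x → x < n → x ≢ z → p x ≡ q x) → count p n ≡ suc (count q n)
  count-insert {p} {q} (suc n) z<1+n pz qz p≡q with m≤n⇒m<n∨m≡n (≤-pred z<1+n)
  ... | inj₁ z<n rewrite count-insert n z<n pz qz (λ x x<n → p≡q x (m<n⇒m<1+n x<n))
                       | p≡q n ≤-refl (>⇒≢ z<n) = refl
  ... | inj₂ refl rewrite pz | qz =
    trans (+-comm _ 1) (cong suc (trans (count-cong n agree) (sym (+-identityʳ _))))
    where
    agree : ∀ x → x < n → p x ≡ q x
    agree x x<n = p≡q x (m<n⇒m<1+n x<n) (<⇒≢ x<n)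

  sum-by-rank : ∀ p (h : ℕ → ℕ) n →
                sumBelow n (λ x → if p x then h (count p x) else 0) ≡ sumBelow (count p n) h
  sum-by-rank p h zero    = refl
  sum-by-rank p h (suc n) rewrite sum-by-rank p h n with p n
  ... | true  = cong (λ m → sumBelow m h) (+-comm 1 (count p n))
  ... | false = trans (+-identityʳ _) (cong (λ m → sumBelow m h) (sym (+-identityʳ (count p n))))

  private
    variable
      X Y : Set

  length-filterᵇ-∷ : ∀ (p : X → Bool) x xs →
                     length (filterᵇ p (x ∷ xs)) ≡ bit (p x) + length (filterᵇ p xs)
  length-filterᵇ-∷ p x xs with p x
  ... | true  = refl
  ... | false = refl

  length-filterᵇ-++ : ∀ (p : X → Bool) xs ys →
                      length (filterᵇ p (xs ++ ys)) ≡ length (filterᵇ p xs) + length (filterᵇ p ys)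
  length-filterᵇ-++ p xs ys =
    trans (cong length (filter-++ (T? ∘ p) xs ys)) (length-++ (filterᵇ p xs))

  length-filterᵇ-cong : ∀ {p q : X → Bool} → (∀ x → p x ≡ q x) → ∀ xs →
                        length (filterᵇ p xs) ≡ length (filterᵇ q xs)
  length-filterᵇ-cong p≡q [] = refl
  length-filterᵇ-cong {p = p} {q} p≡q (x ∷ xs)
    rewrite length-filterᵇ-∷ p x xs | length-filterᵇ-∷ q x xs | p≡q x =
    cong (bit (q x) +_) (length-filterᵇ-cong p≡q xs)

  length-filterᵇ-false : ∀ (xs : List X) → length (filterᵇ (λ _ → false) xs) ≡ 0
  length-filterᵇ-false []       = refl
  length-filterᵇ-false (x ∷ xs) = length-filterᵇ-false xs

  length-filterᵇ-const-∧ : ∀ b (q : X → Bool) xs →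
                    length (filterᵇ (λ x → b ∧ q x) xs) ≡ (if b then length (filterᵇ q xs) else 0)
  length-filterᵇ-const-∧ true  q xs = refl
  length-filterᵇ-const-∧ false q xs = length-filterᵇ-false xs

  length-filterᵇ-map : ∀ (p : Y → Bool) (f : X → Y) xs →
                       length (filterᵇ p (map f xs)) ≡ length (filterᵇ (p ∘ f) xs)
  length-filterᵇ-map p f []       = refl
  length-filterᵇ-map p f (x ∷ xs)
    rewrite length-filterᵇ-∷ p (f x) (map f xs) | length-filterᵇ-∷ (p ∘ f) x xs =
    cong (bit (p (f x)) +_) (length-filterᵇ-map p f xs)

  sum-map-upTo : ∀ (f : ℕ → ℕ) n → sum (map f (upTo n)) ≡ sumBelow n f
  sum-map-upTo f zero    = refl
  sum-map-upTo f (suc n) = begin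
    sum (map f (upTo (suc n)))            ≡⟨ cong (sum ∘ map f) (upTo-∷ʳ n) ⟨
    sum (map f (upTo n ++ n ∷ []))        ≡⟨ cong sum (map-++ f (upTo n) (n ∷ [])) ⟩
    sum (map f (upTo n) ++ f n ∷ [])      ≡⟨ sum-++ (map f (upTo n)) (f n ∷ []) ⟩
    sum (map f (upTo n)) + (f n + 0)      ≡⟨ cong₂ _+_ (sum-map-upTo f n) (+-identityʳ (f n)) ⟩
    sumBelow n f + f n                    ∎
    where open ≡-Reasoning

  length-filterᵇ-allLists : ∀ (p : List ℕ → Bool) b m → length (filterᵇ p (allLists b (suc m)))
                            ≡ sumBelow b (λ x → length (filterᵇ (p ∘ (x ∷_)) (allLists b m)))
  length-filterᵇ-allLists p b m = trans (by-first-letter (upTo b)) (sum-map-upTo _ b)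
    where
    by-first-letter : ∀ xs → length (filterᵇ p (concatMap (λ x → map (x ∷_) (allLists b m)) xs))
                           ≡ sum (map (λ x → length (filterᵇ (p ∘ (x ∷_)) (allLists b m))) xs)
    by-first-letter []       = refl
    by-first-letter (x ∷ xs) =
      trans (length-filterᵇ-++ p (map (x ∷_) (allLists b m)) _)
            (cong₂ _+_ (length-filterᵇ-map p (x ∷_) (allLists b m)) (by-first-letter xs))

  not-∨ : ∀ a b → not (a ∨ b) ≡ not a ∧ not b
  not-∨ true  b = refl
  not-∨ false b = refl

  ≡ᵇ-sym : ∀ x y → (x ≡ᵇ y) ≡ (y ≡ᵇ x)
  ≡ᵇ-sym x y with x ≟ y
  ... | yes refl = refl
  ... | no  x≢y  = trans (dec-false (x ≟ y) x≢y) (sym (dec-false (y ≟ x) (x≢y ∘ sym)))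

  _∈ᵇ_ : ℕ → List ℕ → Bool
  x ∈ᵇ xs = any (x ≡ᵇ_) xs

  ∈ᵇ-∷ʳ : ∀ x ys y → x ∈ᵇ (ys ∷ʳ y) ≡ (x ∈ᵇ ys) ∨ (x ≡ᵇ y)
  ∈ᵇ-∷ʳ x []       y = ∨-identityʳ (x ≡ᵇ y)
  ∈ᵇ-∷ʳ x (z ∷ ys) y =
    trans (cong ((x ≡ᵇ z) ∨_) (∈ᵇ-∷ʳ x ys y)) (sym (∨-assoc (x ≡ᵇ z) _ _))

  ∈ᵇ-∷ʳ-last : ∀ ys x → x ∈ᵇ (ys ∷ʳ x) ≡ true
  ∈ᵇ-∷ʳ-last ys x =
    trans (∈ᵇ-∷ʳ x ys x) (trans (cong (x ∈ᵇ ys ∨_) (dec-true (x ≟ x) refl)) (∨-zeroʳ _))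

  allDistinct-∷ʳ : ∀ xs x → allDistinct (xs ∷ʳ x) ≡ allDistinct xs ∧ not (x ∈ᵇ xs)
  allDistinct-∷ʳ []       x = refl
  allDistinct-∷ʳ (y ∷ xs) x = begin
    not (y ∈ᵇ (xs ∷ʳ x)) ∧ allDistinct (xs ∷ʳ x)
      ≡⟨ cong₂ (λ u v → not u ∧ v) (∈ᵇ-∷ʳ y xs x) (allDistinct-∷ʳ xs x) ⟩
    not (y ∈ᵇ xs ∨ (y ≡ᵇ x)) ∧ (allDistinct xs ∧ not (x ∈ᵇ xs))
      ≡⟨ cong (_∧ (allDistinct xs ∧ not (x ∈ᵇ xs))) (not-∨ (y ∈ᵇ xs) (y ≡ᵇ x)) ⟩
    (not (y ∈ᵇ xs) ∧ not (y ≡ᵇ x)) ∧ (allDistinct xs ∧ not (x ∈ᵇ xs))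
      ≡⟨ ∧-interchange (not (y ∈ᵇ xs)) _ _ _ ⟩
    (not (y ∈ᵇ xs) ∧ allDistinct xs) ∧ (not (y ≡ᵇ x) ∧ not (x ∈ᵇ xs))
      ≡⟨ cong (λ b → (not (y ∈ᵇ xs) ∧ allDistinct xs) ∧ (not b ∧ not (x ∈ᵇ xs)))
              (≡ᵇ-sym y x) ⟩
    (not (y ∈ᵇ xs) ∧ allDistinct xs) ∧ (not (x ≡ᵇ y) ∧ not (x ∈ᵇ xs))
      ≡⟨ cong ((not (y ∈ᵇ xs) ∧ allDistinct xs) ∧_) (not-∨ (x ≡ᵇ y) (x ∈ᵇ xs)) ⟨
    (not (y ∈ᵇ xs) ∧ allDistinct xs) ∧ not ((x ≡ᵇ y) ∨ x ∈ᵇ xs)  ∎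
    where open ≡-Reasoning

  lastOf : ℕ → List ℕ → ℕ
  lastOf y []      = y
  lastOf y (z ∷ w) = lastOf z w

  lastOf-∷ʳ : ∀ y w x → lastOf y (w ∷ʳ x) ≡ x
  lastOf-∷ʳ y []      x = refl
  lastOf-∷ʳ y (z ∷ w) x = lastOf-∷ʳ z w x

  asc-∷ʳ : ∀ y w x → asc ((y ∷ w) ∷ʳ x) ≡ asc (y ∷ w) + bit (lastOf y w <ᵇ x)
  asc-∷ʳ y []      x = +-identityʳ _
  asc-∷ʳ y (z ∷ w) x =
    trans (cong (bit (y <ᵇ z) +_) (asc-∷ʳ z w x)) (sym (+-assoc (bit (y <ᵇ z)) _ _))

  respectsBound : ℕ → List ℕ → ℕ → Bool
  respectsBound k s j = at s j ≤ᵇ k + asc (take j s)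

  -- The checks in isAscentSeq are done by a function local to Defs; abstracting its list
  -- argument lets the unifier recover that function as the first argument of foldr-universal.
  isAscentSeq-∷ : ∀ k y w →
    isAscentSeq k (y ∷ w) ≡ (y ≡ᵇ 0) ∧ all (respectsBound k (y ∷ w)) (applyUpTo suc (length w))
  isAscentSeq-∷ k y w
    with foldr-universal _ (λ j b → respectsBound k (y ∷ w) j ∧ b) true refl (λ _ _ → refl)
       | map suc (upTo (length w))
       | map-upTo suc (length w)
  ... | checks≗foldr | js | js≡ = cong ((y ≡ᵇ 0) ∧_) (begin
    _                                                ≡⟨ checks≗foldr js ⟩
    foldr (λ j b → respectsBound k (y ∷ w) j ∧ b) true js
                                                     ≡⟨ foldr-map _∧_ (respectsBound k (y ∷ w)) true js ⟨
    all (respectsBound k (y ∷ w)) js                 ≡⟨ cong (all _) js≡ ⟩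
    all (respectsBound k (y ∷ w)) (applyUpTo suc (length w)) ∎)
    where open ≡-Reasoning

  all-∷ʳ : ∀ (p : ℕ → Bool) xs x → all p (xs ∷ʳ x) ≡ all p xs ∧ p x
  all-∷ʳ p []       x = ∧-identityʳ (p x)
  all-∷ʳ p (y ∷ xs) x = trans (cong (p y ∧_) (all-∷ʳ p xs x)) (sym (∧-assoc (p y) _ _))

  all-applyUpTo-cong : ∀ {p q : ℕ → Bool} (f : ℕ → ℕ) n →
    (∀ i → i < n → p (f i) ≡ q (f i)) → all p (applyUpTo f n) ≡ all q (applyUpTo f n)
  all-applyUpTo-cong f zero    p≡q = refl
  all-applyUpTo-cong f (suc n) p≡q = cong₂ _∧_ (p≡q 0 (s≤s z≤n))
    (all-applyUpTo-cong (f ∘ suc) n (λ i i<n → p≡q (suc i) (s≤s i<n)))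

  at-++ˡ : ∀ w t i → i < length w → at (w ++ t) i ≡ at w i
  at-++ˡ (x ∷ w) t zero    _         = refl
  at-++ˡ (x ∷ w) t (suc i) (s≤s i<n) = at-++ˡ w t i i<n

  take-++ˡ : ∀ w (t : List ℕ) i → i ≤ length w → take i (w ++ t) ≡ take i w
  take-++ˡ w       t zero    _         = refl
  take-++ˡ (x ∷ w) t (suc i) (s≤s i≤n) = cong (x ∷_) (take-++ˡ w t i i≤n)

  at-∷ʳ-length : ∀ w x → at (w ∷ʳ x) (length w) ≡ x
  at-∷ʳ-length []      x = refl
  at-∷ʳ-length (y ∷ w) x = at-∷ʳ-length w x

  take-∷ʳ-length : ∀ (w : List ℕ) x → take (length w) (w ∷ʳ x) ≡ w
  take-∷ʳ-length []      x = refl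
  take-∷ʳ-length (y ∷ w) x = cong (y ∷_) (take-∷ʳ-length w x)

  length-∷ʳ : ∀ (w : List ℕ) x → length (w ∷ʳ x) ≡ suc (length w)
  length-∷ʳ w x = trans (length-++ w) (+-comm (length w) 1)

  isAscentSeq-∷ʳ : ∀ k y w x →
    isAscentSeq k ((y ∷ w) ∷ʳ x) ≡ isAscentSeq k (y ∷ w) ∧ (x ≤ᵇ k + asc (y ∷ w))
  isAscentSeq-∷ʳ k y w x = begin
    isAscentSeq k ((y ∷ w) ∷ʳ x)
      ≡⟨ isAscentSeq-∷ k y (w ∷ʳ x) ⟩
    (y ≡ᵇ 0) ∧ all bound′ (applyUpTo suc (length (w ∷ʳ x)))
      ≡⟨ cong (λ n → (y ≡ᵇ 0) ∧ all bound′ (applyUpTo suc n)) (length-∷ʳ w x) ⟩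
    (y ≡ᵇ 0) ∧ all bound′ (applyUpTo suc (suc L))
      ≡⟨ cong (λ js → (y ≡ᵇ 0) ∧ all bound′ js) (applyUpTo-∷ʳ suc L) ⟨
    (y ≡ᵇ 0) ∧ all bound′ (applyUpTo suc L ∷ʳ suc L)
      ≡⟨ cong ((y ≡ᵇ 0) ∧_) (all-∷ʳ bound′ (applyUpTo suc L) (suc L)) ⟩
    (y ≡ᵇ 0) ∧ (all bound′ (applyUpTo suc L) ∧ bound′ (suc L))
      ≡⟨ cong₂ (λ u v → (y ≡ᵇ 0) ∧ (u ∧ v)) (all-applyUpTo-cong suc L earlier) last ⟩
    (y ≡ᵇ 0) ∧ (all bound (applyUpTo suc L) ∧ (x ≤ᵇ k + asc (y ∷ w)))
      ≡⟨ ∧-assoc (y ≡ᵇ 0) _ _ ⟨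
    ((y ≡ᵇ 0) ∧ all bound (applyUpTo suc L)) ∧ (x ≤ᵇ k + asc (y ∷ w))
      ≡⟨ cong (_∧ (x ≤ᵇ k + asc (y ∷ w))) (isAscentSeq-∷ k y w) ⟨
    isAscentSeq k (y ∷ w) ∧ (x ≤ᵇ k + asc (y ∷ w))  ∎
    where
    open ≡-Reasoning
    L : ℕ
    L = length w
    bound bound′ : ℕ → Bool
    bound  = respectsBound k (y ∷ w)
    bound′ = respectsBound k ((y ∷ w) ∷ʳ x)
    earlier : ∀ i → i < L → bound′ (suc i) ≡ bound (suc i)
    earlier i i<L =
      cong₂ (λ u v → u ≤ᵇ k + asc (y ∷ v)) (at-++ˡ w [ x ] i i<L) (take-++ˡ w [ x ] i (<⇒≤ i<L))
    last : bound′ (suc L) ≡ (x ≤ᵇ k + asc (y ∷ w))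
    last = cong₂ (λ u v → u ≤ᵇ k + asc (y ∷ v)) (at-∷ʳ-length w x) (take-∷ʳ-length w x)

  isDistinctAscentSeq : ℕ → List ℕ → Bool
  isDistinctAscentSeq k s = isAscentSeq k s ∧ allDistinct s

  admissible : ℕ → List ℕ → ℕ → ℕ → Bool
  admissible k used a x = (x ≤ᵇ k + a) ∧ not (x ∈ᵇ used)

  isDistinctAscentSeq-∷ʳ : ∀ k y w x → isDistinctAscentSeq k ((y ∷ w) ∷ʳ x)
                           ≡ isDistinctAscentSeq k (y ∷ w) ∧ admissible k (y ∷ w) (asc (y ∷ w)) x
  isDistinctAscentSeq-∷ʳ k y w x =
    trans (cong₂ _∧_ (isAscentSeq-∷ʳ k y w x) (allDistinct-∷ʳ (y ∷ w) x))
          (∧-interchange (isAscentSeq k (y ∷ w)) (x ≤ᵇ k + asc (y ∷ w)) (allDistinct (y ∷ w)) _)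

  -- isContinuation k used ℓ a s: s extends a prefix with letters used, last letter ℓ and
  -- a ascents to a longer distinct-letter k-ascent sequence.
  isContinuation : ℕ → List ℕ → ℕ → ℕ → List ℕ → Bool
  isContinuation k used ℓ a []      = true
  isContinuation k used ℓ a (x ∷ s) =
    admissible k used a x ∧ isContinuation k (used ∷ʳ x) x (a + bit (ℓ <ᵇ x)) s

  isDistinctAscentSeq-++ : ∀ k y w s → isDistinctAscentSeq k ((y ∷ w) ++ s)
    ≡ isDistinctAscentSeq k (y ∷ w) ∧ isContinuation k (y ∷ w) (lastOf y w) (asc (y ∷ w)) s
  isDistinctAscentSeq-++ k y w [] =
    trans (cong (λ v → isDistinctAscentSeq k (y ∷ v)) (++-identityʳ w)) (sym (∧-identityʳ _))
  isDistinctAscentSeq-++ k y w (x ∷ s) = begin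
    D ((y ∷ w) ++ x ∷ s)                           ≡⟨ cong D (∷ʳ-++ (y ∷ w) x s) ⟨
    D ((p ∷ʳ x) ++ s)                              ≡⟨ isDistinctAscentSeq-++ k y (w ∷ʳ x) s ⟩
    D (p ∷ʳ x) ∧ C (p ∷ʳ x) (lastOf y (w ∷ʳ x)) (asc (p ∷ʳ x)) s
      ≡⟨ cong₂ (λ ℓ a → D (p ∷ʳ x) ∧ C (p ∷ʳ x) ℓ a s) (lastOf-∷ʳ y w x) (asc-∷ʳ y w x) ⟩
    D (p ∷ʳ x) ∧ C (p ∷ʳ x) x (asc p + bit (lastOf y w <ᵇ x)) s
      ≡⟨ cong (_∧ C (p ∷ʳ x) x _ s) (isDistinctAscentSeq-∷ʳ k y w x) ⟩
    (D p ∧ admissible k p (asc p) x) ∧ C (p ∷ʳ x) x (asc p + bit (lastOf y w <ᵇ x)) s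
      ≡⟨ ∧-assoc (D p) _ _ ⟩
    D p ∧ C p (lastOf y w) (asc p) (x ∷ s)         ∎
    where
    open ≡-Reasoning
    D : List ℕ → Bool
    D = isDistinctAscentSeq k
    C : List ℕ → ℕ → ℕ → List ℕ → Bool
    C = isContinuation k
    p : List ℕ
    p = y ∷ w

  ≤ᵇ-true : ∀ {m n} → m ≤ n → (m ≤ᵇ n) ≡ true
  ≤ᵇ-true = dec-true (_ ≤? _)

  ≤ᵇ-false : ∀ {m n} → n < m → (m ≤ᵇ n) ≡ false
  ≤ᵇ-false n<m = dec-false (_ ≤? _) (<⇒≱ n<m)

  <ᵇ-true : ∀ {m n} → m < n → (m <ᵇ n) ≡ true
  <ᵇ-true = dec-true (_ <? _)

  <ᵇ-false : ∀ {m n} → n ≤ m → (m <ᵇ n) ≡ false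
  <ᵇ-false n≤m = dec-false (_ <? _) (≤⇒≯ n≤m)

  ≡ᵇ-refl : ∀ n → (n ≡ᵇ n) ≡ true
  ≡ᵇ-refl n = dec-true (n ≟ n) refl

  ≡ᵇ-false : ∀ {m n} → m ≢ n → (m ≡ᵇ n) ≡ false
  ≡ᵇ-false = dec-false (_ ≟ _)

  ≤ᵇ-suc : ∀ {y n} → y ≢ suc n → (y ≤ᵇ suc n) ≡ (y ≤ᵇ n)
  ≤ᵇ-suc {y} {n} y≢1+n with y ≤? n
  ... | yes y≤n = trans (≤ᵇ-true (m≤n⇒m≤1+n y≤n)) (sym (≤ᵇ-true y≤n))
  ... | no  y≰n =
    trans (≤ᵇ-false (≤∧≢⇒< (≰⇒> y≰n) (y≢1+n ∘ sym))) (sym (≤ᵇ-false (≰⇒> y≰n)))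

  ∈ᵇ-above : ∀ {n y} xs → All (_≤ n) xs → n < y → y ∈ᵇ xs ≡ false
  ∈ᵇ-above []       []           n<y = refl
  ∈ᵇ-above (x ∷ xs) (x≤n ∷ xs≤n) n<y
    rewrite ≡ᵇ-false (>⇒≢ (≤-<-trans x≤n n<y)) = ∈ᵇ-above xs xs≤n n<y

  count-≤ᵇ : ∀ k n → count (_≤ᵇ k) n ≡ n ⊓ suc k
  count-≤ᵇ k zero = refl
  count-≤ᵇ k (suc n) with n ≤? k
  ... | yes n≤k rewrite ≤ᵇ-true n≤k | count-≤ᵇ k n
                      | m≤n⇒m⊓n≡m (m≤n⇒m≤1+n n≤k) | m≤n⇒m⊓n≡m n≤k = +-comm n 1
  ... | no  n≰k rewrite ≤ᵇ-false (≰⇒> n≰k) | count-≤ᵇ k n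
                      | m≥n⇒m⊓n≡n (≰⇒> n≰k) | m≥n⇒m⊓n≡n (<⇒≤ (≰⇒> n≰k)) = +-identityʳ _

  room-after-letter : ∀ k a c {m b} → k + a + suc m < b → k + (a + bit c) + m < b
  room-after-letter k a c {m} room = ≤-<-trans (begin
    k + (a + bit c) + m ≤⟨ +-monoˡ-≤ m (+-monoʳ-≤ k (+-monoʳ-≤ a (bit≤1 c))) ⟩
    k + (a + 1) + m     ≡⟨ cong (_+ m) (+-assoc k a 1) ⟨
    k + a + 1 + m       ≡⟨ +-assoc (k + a) 1 m ⟩
    k + a + suc m       ∎) room
    where open ≤-Reasoning

  next-letter-below : ∀ k a {m b} → k + a + suc m < b → suc (k + a) < b
  next-letter-below k a {m} room =
    ≤-<-trans (≤-trans (s≤s (m≤m+n (k + a) m)) (≤-reflexive (sym (+-suc (k + a) m)))) room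

  -- extensions n i c: continuations by n letters when c letters are admissible, i of them
  -- below the last letter.
  extensions : ℕ → ℕ → ℕ → ℕ
  extensions zero    i c = 1
  extensions (suc n) i c = sumBelow c (λ r → extensions n r (c ∸ 1 + bit (i ≤ᵇ r)))

  module _ (k : ℕ) where

    admissible-∷ʳ : ∀ used x a y →
      admissible k (used ∷ʳ x) a y ≡ admissible k used a y ∧ not (y ≡ᵇ x)
    admissible-∷ʳ used x a y =
      trans (cong (λ b → (y ≤ᵇ k + a) ∧ not b) (∈ᵇ-∷ʳ y used x))
            (trans (cong ((y ≤ᵇ k + a) ∧_) (not-∨ (y ∈ᵇ used) (y ≡ᵇ x)))
                   (sym (∧-assoc (y ≤ᵇ k + a) _ _)))

    admissible⇒≤ : ∀ used {a x} → admissible k used a x ≡ true → x ≤ k + a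
    admissible⇒≤ used {a} {x} adm with x ≤? k + a
    ... | yes x≤ = x≤
    ... | no  x≰ =
      contradiction (trans (sym adm) (cong (_∧ not (x ∈ᵇ used)) (≤ᵇ-false (≰⇒> x≰)))) λ ()

    rank-after-∷ʳ : ∀ used a a′ x → x ≤ k + a → a ≤ a′ →
      count (admissible k (used ∷ʳ x) a′) x ≡ count (admissible k used a) x
    rank-after-∷ʳ used a a′ x x≤ a≤a′ = count-cong x below
      where
      below : ∀ y → y < x → admissible k (used ∷ʳ x) a′ y ≡ admissible k used a y
      below y y<x rewrite admissible-∷ʳ used x a′ y | ≡ᵇ-false (<⇒≢ y<x)
        | ≤ᵇ-true (≤-trans (<⇒≤ (<-≤-trans y<x x≤)) (+-monoʳ-≤ k a≤a′))
        | ≤ᵇ-true (<⇒≤ (<-≤-trans y<x x≤)) = ∧-identityʳ _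

    ascent⇔rank-≤ : ∀ used a ℓ x → ℓ ∈ᵇ used ≡ true → admissible k used a x ≡ true →
      (ℓ <ᵇ x) ≡ (count (admissible k used a) ℓ ≤ᵇ count (admissible k used a) x)
    ascent⇔rank-≤ used a ℓ x ℓ∈ adm with <-cmp ℓ x
    ... | tri< ℓ<x _ _ = trans (<ᵇ-true ℓ<x) (sym (≤ᵇ-true (count-mono _ (<⇒≤ ℓ<x))))
    ... | tri≈ _ refl _ =
      contradiction (trans (sym adm) (trans (cong (λ b → _ ∧ not b) ℓ∈) (∧-zeroʳ _))) λ ()
    ... | tri> _ _ x<ℓ = trans (<ᵇ-false (<⇒≤ x<ℓ)) (sym (≤ᵇ-false (begin-strict
        count (admissible k used a) x       <⟨ n<1+n _ ⟩
        suc (count (admissible k used a) x) ≡⟨ count-suc x adm ⟨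
        count (admissible k used a) (suc x) ≤⟨ count-mono _ x<ℓ ⟩
        count (admissible k used a) ℓ       ∎)))
      where open ≤-Reasoning

    admissible-count-after-∷ʳ : ∀ used a x b c → All (_≤ k + a) used → admissible k used a x ≡ true →
      suc (k + a) < b →
      count (admissible k (used ∷ʳ x) (a + bit c)) b ≡ count (admissible k used a) b ∸ 1 + bit c
    admissible-count-after-∷ʳ used a x b c used≤ adm room =
      trans (by-ascent c) (cong (_+ bit c) (cong (_∸ 1) (sym remove-x)))
      where
      others : ℕ → Bool
      others y = admissible k used a y ∧ not (y ≡ᵇ x)
      x≤ : x ≤ k + a
      x≤ = admissible⇒≤ used adm
      remove-x : count (admissible k used a) b ≡ suc (count others b)
      remove-x = count-insert b (≤-<-trans x≤ (<-trans (n<1+n _) room)) adm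
        (trans (cong (λ e → admissible k used a x ∧ not e) (≡ᵇ-refl x)) (∧-zeroʳ _))
        (λ y _ y≢x → sym (trans (cong (λ e → admissible k used a y ∧ not e) (≡ᵇ-false y≢x))
                                (∧-identityʳ _)))
      new : ℕ
      new = suc (k + a)
      k+[a+1]≡new : k + (a + 1) ≡ new
      k+[a+1]≡new = trans (cong (k +_) (+-comm a 1)) (+-suc k a)
      by-ascent : ∀ c → count (admissible k (used ∷ʳ x) (a + bit c)) b ≡ count others b + bit c
      by-ascent false = trans (count-cong b λ y _ → trans (admissible-∷ʳ used x (a + 0) y)
          (cong (λ a′ → admissible k used a′ y ∧ not (y ≡ᵇ x)) (+-identityʳ a)))
        (sym (+-identityʳ _))
      by-ascent true = trans (count-insert b room new-admissible new-not-other agree) (+-comm 1 _)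
        where
        new-admissible : admissible k (used ∷ʳ x) (a + 1) new ≡ true
        new-admissible rewrite admissible-∷ʳ used x (a + 1) new | k+[a+1]≡new
          | ≤ᵇ-true (≤-refl {new}) | ∈ᵇ-above used used≤ (n<1+n (k + a))
          | ≡ᵇ-false (>⇒≢ (s≤s x≤)) = refl
        new-not-other : others new ≡ false
        new-not-other rewrite ≤ᵇ-false (n<1+n (k + a)) = refl
        agree : ∀ y → y < b → y ≢ new → admissible k (used ∷ʳ x) (a + 1) y ≡ others y
        agree y _ y≢new rewrite admissible-∷ʳ used x (a + 1) y | k+[a+1]≡new | ≤ᵇ-suc y≢new = refl

    -- allLists b m uses the letters below b; room keeps below b every letter that can become
    -- admissible within m steps.
    count-continuations : ∀ m used ℓ a b → ℓ ∈ᵇ used ≡ true → All (_≤ k + a) used → k + a + m < b →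
      length (filterᵇ (isContinuation k used ℓ a) (allLists b m))
        ≡ extensions m (count (admissible k used a) ℓ) (count (admissible k used a) b)
    count-continuations zero    used ℓ a b ℓ∈ used≤ room = refl
    count-continuations (suc m) used ℓ a b ℓ∈ used≤ room = begin
      length (filterᵇ (isContinuation k used ℓ a) (allLists b (suc m)))
        ≡⟨ length-filterᵇ-allLists _ b m ⟩
      sumBelow b (λ x → length (filterᵇ (λ s → adm x ∧ rest x s) (allLists b m)))
        ≡⟨ sumBelow-cong b (λ x _ → length-filterᵇ-const-∧ (adm x) (rest x) (allLists b m)) ⟩
      sumBelow b (λ x → if adm x then length (filterᵇ (rest x) (allLists b m)) else 0)
        ≡⟨ sumBelow-cong b (λ x _ → by-letter x) ⟩
      sumBelow b (λ x → if adm x then H (rank x) else 0)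
        ≡⟨ sum-by-rank adm H b ⟩
      sumBelow (rank b) H
        ∎
      where
      open ≡-Reasoning
      adm : ℕ → Bool
      adm = admissible k used a
      rank : ℕ → ℕ
      rank = count adm
      rest : ℕ → List ℕ → Bool
      rest x = isContinuation k (used ∷ʳ x) x (a + bit (ℓ <ᵇ x))
      H : ℕ → ℕ
      H r = extensions m r (rank b ∸ 1 + bit (rank ℓ ≤ᵇ r))
      by-letter : ∀ x → (if adm x then length (filterᵇ (rest x) (allLists b m)) else 0)
                        ≡ (if adm x then H (rank x) else 0)
      by-letter x with adm x in adm-x
      ... | false = refl
      ... | true  = begin
        length (filterᵇ (rest x) (allLists b m))
          ≡⟨ count-continuations m (used ∷ʳ x) x a′ b (∈ᵇ-∷ʳ-last used x) used′≤
                                 (room-after-letter k a (ℓ <ᵇ x) room) ⟩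
        extensions m (count adm′ x) (count adm′ b)
          ≡⟨ cong₂ (extensions m) (rank-after-∷ʳ used a _ x x≤ (m≤m+n a _))
                 (admissible-count-after-∷ʳ used a x b (ℓ <ᵇ x) used≤ adm-x (next-letter-below k a room)) ⟩
        extensions m (rank x) (rank b ∸ 1 + bit (ℓ <ᵇ x))
          ≡⟨ cong (λ e → extensions m (rank x) (rank b ∸ 1 + bit e))
                  (ascent⇔rank-≤ used a ℓ x ℓ∈ adm-x) ⟩
        H (rank x) ∎
        where
        a′ : ℕ
        a′ = a + bit (ℓ <ᵇ x)
        adm′ : ℕ → Bool
        adm′ = admissible k (used ∷ʳ x) a′
        x≤ : x ≤ k + a
        x≤ = admissible⇒≤ used adm-x
        used′≤ : All (_≤ k + a′) (used ∷ʳ x)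
        used′≤ = All.map (λ y≤ → ≤-trans y≤ (+-monoʳ-≤ k (m≤m+n a _))) (++⁺ used≤ (x≤ ∷ []))

    initial-rank : ∀ m → count (admissible k (0 ∷ []) 0) (suc m + k) ≡ k
    initial-rank m = suc-injective (begin
      suc (count (admissible k (0 ∷ []) 0) (suc m + k))
        ≡⟨ count-insert (suc m + k) (s≤s z≤n) refl refl agree ⟨
      count (_≤ᵇ k) (suc m + k)  ≡⟨ count-≤ᵇ k (suc m + k) ⟩
      (suc m + k) ⊓ suc k        ≡⟨ cong suc (m≥n⇒m⊓n≡n (m≤n+m k m)) ⟩
      suc k                      ∎)
      where
      open ≡-Reasoning
      agree : ∀ y → y < suc m + k → y ≢ 0 → (y ≤ᵇ k) ≡ admissible k (0 ∷ []) 0 y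
      agree zero    _ y≢0 = contradiction refl y≢0
      agree (suc y) _ _   = sym (trans (∧-identityʳ _) (cong (suc y ≤ᵇ_) (+-identityʳ k)))

    count-distinct-ascent-seqs : ∀ m →
      length (filterᵇ (isDistinctAscentSeq k) (allLists (suc m + k) (suc m))) ≡ extensions m 0 k
    count-distinct-ascent-seqs m = begin
      length (filterᵇ (isDistinctAscentSeq k) (allLists b (suc m)))
        ≡⟨ length-filterᵇ-allLists _ b m ⟩
      sumBelow b (λ x → length (filterᵇ (isDistinctAscentSeq k ∘ (x ∷_)) (allLists b m)))
        ≡⟨ sumBelow-only-zero (m + k) (λ _ → length-filterᵇ-false (allLists b m)) ⟩
      length (filterᵇ (isDistinctAscentSeq k ∘ (0 ∷_)) (allLists b m))
        ≡⟨ length-filterᵇ-cong (isDistinctAscentSeq-++ k 0 []) (allLists b m) ⟩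
      length (filterᵇ (isContinuation k (0 ∷ []) 0 0) (allLists b m))
        ≡⟨ count-continuations m (0 ∷ []) 0 0 b refl (z≤n ∷ []) room ⟩
      extensions m 0 (count (admissible k (0 ∷ []) 0) b)
        ≡⟨ cong (extensions m 0) (initial-rank m) ⟩
      extensions m 0 k ∎
      where
      open ≡-Reasoning
      b : ℕ
      b = suc m + k
      room : k + 0 + m < b
      room = s≤s (≤-reflexive (trans (cong (_+ m) (+-identityʳ k)) (+-comm k m)))

  a3-00-as-extensions : ∀ m → a3-00 (suc m) ≡ extensions m 0 3
  a3-00-as-extensions = count-distinct-ascent-seqs 3

module GeneratingFunction where

  open Counting using (extensions)
  open import Data.Nat as ℕ using (zero; suc; _∸_)
  import Data.Nat.Properties as ℕ
  open import Data.Integer using (ℤ; +_; 0ℤ; _+_; _-_; _*_)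
  open import Data.Integer.Properties using (*-zeroʳ; +-identityˡ)
  open import Data.Integer.Tactic.RingSolver using (solve-∀)
  open import Data.List using (map; foldr; upTo; applyUpTo)
  open import Data.List.Properties using (foldr-universal; map-cong; map-applyUpTo; map-upTo)
  open import Function using (_∘_)
  open import Relation.Binary.PropositionalEquality

  Δ : (ℕ → ℤ) → ℕ → ℤ
  Δ f n = f (suc n) - f n

  Δ^ : ℕ → (ℕ → ℤ) → ℕ → ℤ
  Δ^ zero    f = f
  Δ^ (suc d) f = Δ^ d (Δ f)

  Δ^-cong : ∀ d {f g : ℕ → ℤ} → (∀ n → f n ≡ g n) → ∀ n → Δ^ d f n ≡ Δ^ d g n
  Δ^-cong zero    f≗g = f≗g
  Δ^-cong (suc d) f≗g = Δ^-cong d (λ n → cong₂ _-_ (f≗g (suc n)) (f≗g n))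

  Δ^-+ : ∀ d f g n → Δ^ d (λ m → f m + g m) n ≡ Δ^ d f n + Δ^ d g n
  Δ^-+ zero    f g n = refl
  Δ^-+ (suc d) f g n =
    trans (Δ^-cong d (λ m → regroup (f (suc m)) (g (suc m)) (f m) (g m)) n) (Δ^-+ d (Δ f) (Δ g) n)
    where
    regroup : ∀ a b a′ b′ → (a + b) - (a′ + b′) ≡ (a - a′) + (b - b′)
    regroup = solve-∀

  Δ^-suc : ∀ d f n → Δ^ (suc d) f n ≡ Δ (Δ^ d f) n
  Δ^-suc zero    f n = refl
  Δ^-suc (suc d) f n = Δ^-suc d (Δ f) n

  record DegreeBelow (d : ℕ) (f : ℕ → ℤ) : Set where
    constructor Δ^-vanishing
    field Δ^-vanishes : ∀ n → Δ^ d f n ≡ 0ℤ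

  open DegreeBelow public

  degreeBelow-suc : ∀ {d f} → DegreeBelow d f → DegreeBelow (suc d) f
  degreeBelow-suc {d} {f} deg =
    Δ^-vanishing λ n →
      trans (Δ^-suc d f n) (cong₂ _-_ (Δ^-vanishes deg (suc n)) (Δ^-vanishes deg n))

  degreeBelow-+ : ∀ {d f g} → DegreeBelow d f → DegreeBelow d g → DegreeBelow d (λ n → f n + g n)
  degreeBelow-+ {d} {f} {g} degf degg =
    Δ^-vanishing λ n →
      trans (Δ^-+ d f g n) (cong₂ _+_ (Δ^-vanishes degf n) (Δ^-vanishes degg n))

  degreeBelow-increments : ∀ {d} (f g : ℕ → ℕ) → (∀ n → f (suc n) ≡ f n ℕ.+ g n) →
    DegreeBelow d (λ n → + g n) → DegreeBelow (suc d) (λ n → + f n)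
  degreeBelow-increments {d} f g step degg =
    Δ^-vanishing λ n → trans (Δ^-cong d Δf≗g n) (Δ^-vanishes degg n)
    where
    cancel : ∀ a b → (a + b) - a ≡ b
    cancel = solve-∀
    Δf≗g : ∀ n → Δ (λ m → + f m) n ≡ + g n
    Δf≗g n = trans (cong (λ x → + x - + f n) (step n)) (cancel (+ f n) (+ g n))

  thirdDifference : (ℕ → ℤ) → ℕ → ℤ
  thirdDifference f n = f (3 ℕ.+ n) - + 3 * f (2 ℕ.+ n) + + 3 * f (1 ℕ.+ n) - f n

  Δ^3≗thirdDifference : ∀ f n → Δ^ 3 f n ≡ thirdDifference f n
  Δ^3≗thirdDifference f n = expand (f n) (f (1 ℕ.+ n)) (f (2 ℕ.+ n)) (f (3 ℕ.+ n))
    where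
    expand : ∀ a b c d → ((d - c) - (c - b)) - ((c - b) - (b - a)) ≡ d - + 3 * c + + 3 * b - a
    expand = solve-∀

  -- The summation in _·_ is local to Defs and is recovered as in isAscentSeq-∷.
  ·-as-sum : ∀ f g n → (f · g) n ≡ foldr _+_ 0ℤ (map (λ k → f k * g (n ∸ k)) (upTo (suc n)))
  ·-as-sum f g n with foldr-universal _ _+_ 0ℤ refl (λ _ _ → refl)
                     | map (λ k → f k * g (n ∸ k)) (applyUpTo suc n)
  ... | sum≗foldr | terms = cong (_+_ (f 0 * g n)) (sum≗foldr terms)

  ·-congˡ : ∀ {f f′} g → (∀ k → f k ≡ f′ k) → ∀ n → (f · g) n ≡ (f′ · g) n
  ·-congˡ {f} {f′} g f≗f′ n = begin
    (f · g) n
      ≡⟨ ·-as-sum f g n ⟩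
    foldr _+_ 0ℤ (map (λ k → f k * g (n ∸ k)) (upTo (suc n)))
      ≡⟨ cong (foldr _+_ 0ℤ) (map-cong (λ k → cong (_* g (n ∸ k)) (f≗f′ k)) (upTo (suc n))) ⟩
    foldr _+_ 0ℤ (map (λ k → f′ k * g (n ∸ k)) (upTo (suc n)))
      ≡⟨ ·-as-sum f′ g n ⟨
    (f′ · g) n ∎
    where open ≡-Reasoning

  ·-suc : ∀ f g n → (f · g) (suc n) ≡ f 0 * g (suc n) + ((f ∘ suc) · g) n
  ·-suc f g n = begin
    (f · g) (suc n)
      ≡⟨ ·-as-sum f g (suc n) ⟩
    f 0 * g (suc n) + foldr _+_ 0ℤ (map term (applyUpTo suc (suc n)))
      ≡⟨ cong (λ l → f 0 * g (suc n) + foldr _+_ 0ℤ l)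
              (trans (map-applyUpTo suc term (suc n)) (sym (map-upTo (term ∘ suc) (suc n)))) ⟩
    f 0 * g (suc n) + foldr _+_ 0ℤ (map (term ∘ suc) (upTo (suc n)))
      ≡⟨ cong (_+_ (f 0 * g (suc n))) (·-as-sum (f ∘ suc) g n) ⟨
    f 0 * g (suc n) + ((f ∘ suc) · g) n ∎
    where
    open ≡-Reasoning
    term : ℕ → ℤ
    term k = f k * g (suc n ∸ k)

  ·-window : ∀ d f g → (∀ j → g (d ℕ.+ suc j) ≡ 0ℤ) →
             ∀ N → (f · g) (d ℕ.+ N) ≡ ((λ j → f (j ℕ.+ N)) · g) d
  ·-window d f g g-vanishes zero =
    trans (cong (f · g) (ℕ.+-identityʳ d)) (·-congˡ g (λ j → cong f (sym (ℕ.+-identityʳ j))) d)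
  ·-window d f g g-vanishes (suc N) = begin
    (f · g) (d ℕ.+ suc N)                      ≡⟨ cong (f · g) (ℕ.+-suc d N) ⟩
    (f · g) (suc (d ℕ.+ N))                    ≡⟨ ·-suc f g (d ℕ.+ N) ⟩
    f 0 * g (suc (d ℕ.+ N)) + ((f ∘ suc) · g) (d ℕ.+ N)
      ≡⟨ cong (λ c → f 0 * c + ((f ∘ suc) · g) (d ℕ.+ N))
              (trans (cong g (sym (ℕ.+-suc d N))) (g-vanishes N)) ⟩
    f 0 * 0ℤ + ((f ∘ suc) · g) (d ℕ.+ N)       ≡⟨ cong (_+ ((f ∘ suc) · g) (d ℕ.+ N)) (*-zeroʳ (f 0)) ⟩
    0ℤ + ((f ∘ suc) · g) (d ℕ.+ N)             ≡⟨ +-identityˡ _ ⟩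
    ((f ∘ suc) · g) (d ℕ.+ N)                  ≡⟨ ·-window d (f ∘ suc) g g-vanishes N ⟩
    ((λ j → f (suc (j ℕ.+ N))) · g) d          ≡⟨ ·-congˡ g (λ j → cong f (sym (ℕ.+-suc j N))) d ⟩
    ((λ j → f (j ℕ.+ suc N)) · g) d            ∎
    where open ≡-Reasoning

  Δ^6-as-convolution : ∀ f n → Δ^ 6 f n ≡ ((λ j → f (j ℕ.+ n)) · denom) 6
  Δ^6-as-convolution f n = begin
    Δ^ 3 (Δ^ 3 f) n                       ≡⟨ Δ^-cong 3 (Δ^3≗thirdDifference f) n ⟩
    Δ^ 3 (thirdDifference f) n            ≡⟨ Δ^3≗thirdDifference (thirdDifference f) n ⟩
    thirdDifference (thirdDifference f) n ≡⟨ binomial (f n) (f (1 ℕ.+ n)) (f (2 ℕ.+ n)) (f (3 ℕ.+ n))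
                                                     (f (4 ℕ.+ n)) (f (5 ℕ.+ n)) (f (6 ℕ.+ n)) ⟩
    ((λ j → f (j ℕ.+ n)) · denom) 6       ∎
    where
    open ≡-Reasoning
    binomial : ∀ a₀ a₁ a₂ a₃ a₄ a₅ a₆ →
      (a₆ - + 3 * a₅ + + 3 * a₄ - a₃) - + 3 * (a₅ - + 3 * a₄ + + 3 * a₃ - a₂)
        + + 3 * (a₄ - + 3 * a₃ + + 3 * a₂ - a₁) - (a₃ - + 3 * a₂ + + 3 * a₁ - a₀)
      ≡ a₀ * denom 6 + (a₁ * denom 5 + (a₂ * denom 4 + (a₃ * denom 3
          + (a₄ * denom 2 + (a₅ * denom 1 + (a₆ * denom 0 + 0ℤ))))))
    binomial = solve-∀

  x·_ : (ℕ → ℤ) → FPS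
  (x· f) zero    = 0ℤ
  (x· f) (suc n) = f n

  extensionsℤ : ℕ → ℕ → ℕ → ℤ
  extensionsℤ i c n = + extensions n i c

  -- Each increment is extensions (suc n) i c unfolded, e.g.
  -- e 0 3 (suc n) = e 0 3 n + e 1 3 n + e 2 3 n.
  degree-extensions-0-3 : DegreeBelow 6 (extensionsℤ 0 3)
  degree-extensions-0-3 =
    degreeBelow-increments (e 0 3) (e 1 3 ⊕ e 2 3) (λ n → ℕ.+-assoc (e 0 3 n) _ _)
      (degreeBelow-+ deg-1-3 (degreeBelow-suc deg-2-3))
    where
    e : ℕ → ℕ → ℕ → ℕ
    e i c n = extensions n i c
    _⊕_ : (ℕ → ℕ) → (ℕ → ℕ) → ℕ → ℕ
    (f ⊕ g) n = f n ℕ.+ g n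
    deg-0-1 : DegreeBelow 1 (extensionsℤ 0 1)
    deg-0-1 = degreeBelow-increments (e 0 1) (λ _ → 0) (λ n → sym (ℕ.+-identityʳ (e 0 1 n)))
      (Δ^-vanishing λ _ → refl)
    deg-1-2 : DegreeBelow 2 (extensionsℤ 1 2)
    deg-1-2 = degreeBelow-increments (e 1 2) (e 0 1) (λ n → ℕ.+-comm (e 0 1 n) (e 1 2 n)) deg-0-1
    deg-0-2 : DegreeBelow 3 (extensionsℤ 0 2)
    deg-0-2 = degreeBelow-increments (e 0 2) (e 1 2) (λ n → refl) deg-1-2
    deg-2-3 : DegreeBelow 4 (extensionsℤ 2 3)
    deg-2-3 = degreeBelow-increments (e 2 3) (e 0 2 ⊕ e 1 2)
      (λ n → ℕ.+-comm ((e 0 2 ⊕ e 1 2) n) (e 2 3 n))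
      (degreeBelow-+ deg-0-2 (degreeBelow-suc deg-1-2))
    deg-1-3 : DegreeBelow 5 (extensionsℤ 1 3)
    deg-1-3 = degreeBelow-increments (e 1 3) (e 0 2 ⊕ e 2 3)
      (λ n → trans (cong (ℕ._+ e 2 3 n) (ℕ.+-comm (e 0 2 n) (e 1 3 n))) (ℕ.+-assoc (e 1 3 n) _ _))
      (degreeBelow-+ (degreeBelow-suc deg-0-2) deg-2-3)

open Counting using (a3-00-as-extensions)
open GeneratingFunction
open import Data.Nat as ℕ using (zero; suc)
open import Data.Integer using (ℤ; +_; 0ℤ)
open import Relation.Binary.PropositionalEquality using (refl; cong; trans; module ≡-Reasoning)

A≗x·extensions : ∀ n → A n ≡ (x· extensionsℤ 0 3) n
A≗x·extensions zero    = refl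
A≗x·extensions (suc m) = cong +_ (a3-00-as-extensions m)

theorem4p3 : ∀ (n : ℕ) → (A · denom) n ≡ numer n
theorem4p3 n = trans (·-congˡ denom A≗x·extensions n) (coefficient n)
  where
  open ≡-Reasoning
  a : ℕ → ℤ
  a = extensionsℤ 0 3
  coefficient : ∀ n → ((x· a) · denom) n ≡ numer n
  coefficient 0 = refl
  coefficient 1 = refl
  coefficient 2 = refl
  coefficient 3 = refl
  coefficient 4 = refl
  coefficient 5 = refl
  coefficient 6 = refl
  coefficient (suc (suc (suc (suc (suc (suc (suc N))))))) = begin
    ((x· a) · denom) (6 ℕ.+ suc N)            ≡⟨ ·-window 6 (x· a) denom (λ _ → refl) (suc N) ⟩
    ((λ j → (x· a) (j ℕ.+ suc N)) · denom) 6  ≡⟨⟩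
    ((λ j → a (j ℕ.+ N)) · denom) 6           ≡⟨ Δ^6-as-convolution a N ⟨
    Δ^ 6 a N                                  ≡⟨ Δ^-vanishes degree-extensions-0-3 N ⟩
    0ℤ                                        ∎
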